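{- Let $\mathcal T$ be a basic theory and $\zeta\Rightarrow_r\eta$ a graded implication. If there is a forest proof of $\zeta\Rightarrow_r\eta$ from $\mathcal T$, then $\mathcal T\vdash\zeta\Rightarrow_r\eta$ in the calculus $\mathbf{LAE}$.
   Context: Boolean formulas are built from countably many variables and $\bot,\top$ via $\wedge,\vee,\neg$; $\alpha,\beta$ are Boolean equivalent if $\alpha\to\beta$ and $\beta\to\alpha$ are classical tautologies. A graded implication is $\alpha\Rightarrow_d\beta$, $d\in\mathbb R^+=[0,\infty)$. The calculus $\mathbf{LAE}$ has rules ($c,d\in\mathbb R^+$): (R1) $\alpha\Rightarrow_0\beta$ whenever $\alpha\to\beta$ is a classical tautology; (R2) from $\alpha\Rightarrow_0\beta$ infer $\alpha\wedge\gamma\Rightarrow_0\beta\wedge\gamma$; (R3) from $\alpha\Rightarrow_c\beta$ infer $\alpha\Rightarrow_d\beta$ for $d\ge c$; (R4) from $\alpha\Rightarrow_c\bot$ infer $\alpha\Rightarrow_0\bot$; (R5) from $\alpha\Rightarrow_c\gamma$ and $\beta\Rightarrow_c\gamma$ infer $\alpha\vee\beta\Rightarrow_c\gamma$; (R6) from $\alpha\Rightarrow_c\beta$ and $\beta\Rightarrow_d\gamma$ infer $\alpha\Rightarrow_{c+d}\gamma$. $\mathcal T\vdash\Phi$ means there is a finite sequence ending in $\Phi$ each member of which is in $\mathcal T$ or follows from earlier members by a rule. A literal is $\phi$ or $\neg\phi$ for a variable $\phi$; a clause is a finite set of literals, inconsistent if it contains some $\phi$ and $\neg\phi$, consistent otherwise;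 a clause set is a finite set of clauses. For a clause set $B$, $f(B)=\bigvee_{L\in B}\bigwedge L$ (empty conjunction $=\top$, empty disjunction $=\bot$); $B$ is a clause set for $\alpha$ if $f(B)$ is Boolean equivalent to $\alpha$. A basic implication is $\lambda_1\wedge\dots\wedge\lambda_n\Rightarrow_d\bigvee_{i=1}^l\bigwedge_{j=1}^{k_i}\mu_{ij}$ with $n\ge1$, $l\ge0$, $k_i\ge1$, where $\{\lambda_1,\dots,\lambda_n\}$ and all $\{\mu_{i1},\dots,\mu_{ik_i}\}$ are consistent clauses; a basic theory is a set of basic implications. A proof forest is a finite directed forest (each component a rooted tree, edges directed from father to child) with a weight in $\mathbb R^+$ on each edge, each node labelled by a clause or by the symbol $\divideontimes$ (nodes identified with labels; nodes not labelled $\divideontimes$ are proper). A branch is a maximal root-to-leaf path; its length is $0$ if it contains $\divideontimes$ and otherwise the sum of its edge weights; the length of the forest is the maximum length of its branches. A forest proof of $\zeta\Rightarrow_r\eta$ from a basic theory $\mathcal T$ is a proof forest such that: (T1) there is a clause set $B_\zeta$ for $\zeta$ such that each clause of $B_\zeta$ has a root that is a subset of it; (T2) there is a clause set $B_\eta$ for $\eta$ such that every terminal clause includes some clause of $B_\eta$; (T3) the length of the forest is at most $r$; (T4) for every non-terminal clause $L$, all edges from $L$ have the same weight $c$, and one of: (A) $c=0$ and $\mathcal T$ contains a basic implication $\lambda_1\wedge\dots\wedge\lambda_n\Rightarrow_0\bigvee_{i=1}^l\bigwedge_j\mu_{ij}$ with $\{\lambda_1,\dots,\lambda_n\}\subseteq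 L$ such that for each $i$ some child of $L$ is a clause $L'\subseteq\{\mu_{i1},\dots,\mu_{ik_i}\}\cup L$; (B) $c>0$ and $\mathcal T$ contains a basic implication $\lambda_1\wedge\dots\wedge\lambda_n\Rightarrow_c\bigvee_{i=1}^l\bigwedge_j\mu_{ij}$ with $\{\lambda_1,\dots,\lambda_n\}\subseteq L$ such that for each $i$ some child of $L$ is a clause $L'\subseteq\{\mu_{i1},\dots,\mu_{ik_i}\}$; (C) $c=0$, $L$ is inconsistent and $\divideontimes$ is the only child of $L$; (D) $c=0$ and for some variable $\phi$, $L$ has exactly two children, one consisting of $\phi$ together with a subset of $L$, the other of $\neg\phi$ together with a subset of $L$. -}

module Defs where

open import Level using (Level)
open import Data.Nat using (ℕ)
open import Data.Bool using (Bool; true; false; _∧_; _∨_; not; if_then_else_)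
open import Data.List using (List; []; _∷_; map; _++_)
open import Data.List.Membership.Propositional using (_∈_)
open import Data.List.Relation.Binary.Subset.Propositional using (_⊆_)
open import Data.List.Relation.Unary.All using (All)
open import Data.Product using (Σ; ∃; ∃-syntax; _×_; _,_; proj₁; proj₂)
open import Data.Sum using (_⊎_)
open import Data.Unit using (⊤)
open import Data.Empty using (⊥)
open import Relation.Nullary using (¬_)
open import Relation.Binary.PropositionalEquality using (_≡_; _≢_)
open import Algebra.Structures using (IsCommutativeRing)
open import Relation.Binary.Structures using (IsTotalOrder)

-- The real numbers, given axiomatically as a complete ordered field
-- (every model is isomorphic to ℝ).

record Reals : Set₁ where
  infixl 6 _+_
  infixl 7 _*_
  infix  4 _≤_
  field
    Carrier : Set
    0# 1#   : Carrier
    _+_ _*_ : Carrier → Carrier → Carrier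
    -_      : Carrier → Carrier
    _≤_     : Carrier → Carrier → Set
    isCommutativeRing : IsCommutativeRing _≡_ _+_ _*_ -_ 0# 1#
    0≢1     : 0# ≢ 1#
    inverse : ∀ x → x ≢ 0# → ∃[ y ] (x * y ≡ 1#)
    isTotalOrder : IsTotalOrder _≡_ _≤_
    +-mono-≤ : ∀ x y z → x ≤ y → x + z ≤ y + z
    *-nonneg : ∀ x y → 0# ≤ x → 0# ≤ y → 0# ≤ x * y
    complete : (P : Carrier → Set) → ∃ P → (∃[ b ] (∀ x → P x → x ≤ b)) →
               ∃[ s ] ((∀ x → P x → x ≤ s) ×
                       (∀ b → (∀ x → P x → x ≤ b) → s ≤ b))

  _<_ : Carrier → Carrier → Set
  x < y = x ≤ y × x ≢ y

infixr 7 _∧ᶠ_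
infixr 6 _∨ᶠ_

data Formula : Set where
  var  : ℕ → Formula
  ⊥ᶠ ⊤ᶠ : Formula
  _∧ᶠ_ _∨ᶠ_ : Formula → Formula → Formula
  ¬ᶠ_  : Formula → Formula

eval : (ℕ → Bool) → Formula → Bool
eval v (var n)   = v n
eval v ⊥ᶠ        = false
eval v ⊤ᶠ        = true
eval v (a ∧ᶠ b)  = eval v a ∧ eval v b
eval v (a ∨ᶠ b)  = eval v a ∨ eval v b
eval v (¬ᶠ a)    = not (eval v a)

_→ᶠ_ : Formula → Formula → Formula
a →ᶠ b = ¬ᶠ a ∨ᶠ b

Tautology : Formula → Set
Tautology a = ∀ (v : ℕ → Bool) → eval v a ≡ true

BoolEquiv : Formula → Formula → Set
BoolEquiv a b = Tautology (a →ᶠ b) × Tautology (b →ᶠ a)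

⋀ : List Formula → Formula
⋀ []           = ⊤ᶠ
⋀ (x ∷ [])     = x
⋀ (x ∷ y ∷ ys) = x ∧ᶠ ⋀ (y ∷ ys)

⋁ : List Formula → Formula
⋁ []           = ⊥ᶠ
⋁ (x ∷ [])     = x
⋁ (x ∷ y ∷ ys) = x ∨ᶠ ⋁ (y ∷ ys)

data Literal : Set where
  pos neg : ℕ → Literal

litF : Literal → Formula
litF (pos n) = var n
litF (neg n) = ¬ᶠ var n

-- a clause is a finite set of literals (a list, read as a set)
Clause : Set
Clause = List Literal

Inconsistent : Clause → Set
Inconsistent L = ∃[ φ ] (pos φ ∈ L × neg φ ∈ L)

Consistent : Clause → Set
Consistent L = ¬ Inconsistent L

clauseF : Clause → Formula
clauseF L = ⋀ (map litF L)

ClauseSet : Set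
ClauseSet = List Clause

f : ClauseSet → Formula
f B = ⋁ (map clauseF B)

ClauseSetFor : ClauseSet → Formula → Set
ClauseSetFor B α = BoolEquiv (f B) α

module WithReals (ℝ : Reals) where
  open Reals ℝ

  -- graded implications α ⇒_d β  (d ∈ ℝ⁺ is required where they are used)
  infix 4 _⇒[_]_
  record GImp : Set where
    constructor _⇒[_]_
    field
      ante  : Formula
      grade : Carrier
      cons  : Formula

  record BasicImp : Set where
    field
      lhs        : Clause
      lhs-nonempty : lhs ≢ []
      lhs-consistent : Consistent lhs
      wt         : Carrier
      wt-nonneg  : 0# ≤ wt
      rhs        : List Clause
      rhs-nonempty : All (λ K → K ≢ []) rhs
      rhs-consistent : All Consistent rhs

  toGImp : BasicImp → GImp
  toGImp b = clauseF (BasicImp.lhs b) ⇒[ BasicImp.wt b ] f (BasicImp.rhs b)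

  Theory : Set₁
  Theory = GImp → Set

  BasicTheory : Theory → Set
  BasicTheory T = ∀ Φ → T Φ → Σ BasicImp (λ b → toGImp b ≡ Φ)

  infix 3 _⊢_
  data _⊢_ (T : Theory) : GImp → Set where
    hyp : ∀ {Φ} → T Φ → T ⊢ Φ
    R1  : ∀ {α β} → Tautology (α →ᶠ β) → T ⊢ (α ⇒[ 0# ] β)
    R2  : ∀ {α β γ} → T ⊢ (α ⇒[ 0# ] β) → T ⊢ (α ∧ᶠ γ ⇒[ 0# ] β ∧ᶠ γ)
    R3  : ∀ {α β c d} → 0# ≤ c → 0# ≤ d → c ≤ d →
          T ⊢ (α ⇒[ c ] β) → T ⊢ (α ⇒[ d ] β)
    R4  : ∀ {α c} → 0# ≤ c → T ⊢ (α ⇒[ c ] ⊥ᶠ) → T ⊢ (α ⇒[ 0# ] ⊥ᶠ)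
    R5  : ∀ {α β γ c} → 0# ≤ c →
          T ⊢ (α ⇒[ c ] γ) → T ⊢ (β ⇒[ c ] γ) → T ⊢ (α ∨ᶠ β ⇒[ c ] γ)
    R6  : ∀ {α β γ c d} → 0# ≤ c → 0# ≤ d →
          T ⊢ (α ⇒[ c ] β) → T ⊢ (β ⇒[ d ] γ) → T ⊢ (α ⇒[ c + d ] γ)

  ℝ⁺ : Set
  ℝ⁺ = Σ Carrier (λ x → 0# ≤ x)

  data Label : Set where
    clause : Clause → Label
    star   : Label

  -- a rooted tree; each child comes with the weight of the edge to it
  data Tree : Set where
    node : Label → List (ℝ⁺ × Tree) → Tree

  Forest : Set
  Forest = List Tree

  root : Tree → Label
  root (node l _) = l

  data Branch : Tree → Set where
    leaf : ∀ {l} → Branch (node l [])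
    step : ∀ {l cs w t} → (w , t) ∈ cs → Branch t → Branch (node l cs)

  isStar : Label → Bool
  isStar star       = true
  isStar (clause _) = false

  hasStar : ∀ {t} → Branch t → Bool
  hasStar (leaf {l})       = isStar l
  hasStar (step {l} _ b)   = isStar l ∨ hasStar b

  weightSum : ∀ {t} → Branch t → Carrier
  weightSum leaf               = 0#
  weightSum (step {w = w} _ b) = proj₁ w + weightSum b

  branchLength : ∀ {t} → Branch t → Carrier
  branchLength b = if hasStar b then 0# else weightSum b

  data Every (P : Label → List (ℝ⁺ × Tree) → Set) : Tree → Set where
    every : ∀ {l cs} → P l cs → All (λ e → Every P (proj₂ e)) cs →
            Every P (node l cs)

  SomeChildWithin : List (ℝ⁺ × Tree) → Clause → Set
  SomeChildWithin cs S =
    ∃[ e ] (e ∈ cs × ∃[ L' ] (root (proj₂ e) ≡ clause L' × L' ⊆ S))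

  LitPlusSubset : Literal → Clause → ℝ⁺ × Tree → Set
  LitPlusSubset x L e =
    ∃[ L' ] (root (proj₂ e) ≡ clause L' × x ∈ L' × L' ⊆ x ∷ L)

  module _ (T : Theory) where

    CaseA : Clause → List (ℝ⁺ × Tree) → Carrier → Set
    CaseA L cs c = c ≡ 0# × Σ BasicImp (λ b →
      T (toGImp b) × BasicImp.wt b ≡ 0# × BasicImp.lhs b ⊆ L ×
      All (λ μ → SomeChildWithin cs (μ ++ L)) (BasicImp.rhs b))

    CaseB : Clause → List (ℝ⁺ × Tree) → Carrier → Set
    CaseB L cs c = 0# < c × Σ BasicImp (λ b →
      T (toGImp b) × BasicImp.wt b ≡ c × BasicImp.lhs b ⊆ L ×
      All (λ μ → SomeChildWithin cs μ) (BasicImp.rhs b))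

    CaseC : Clause → List (ℝ⁺ × Tree) → Carrier → Set
    CaseC L cs c = c ≡ 0# × Inconsistent L ×
      ∃[ e ] (cs ≡ e ∷ [] × root (proj₂ e) ≡ star)

    CaseD : Clause → List (ℝ⁺ × Tree) → Carrier → Set
    CaseD L cs c = c ≡ 0# × ∃[ φ ] ∃[ e₁ ] ∃[ e₂ ] (cs ≡ e₁ ∷ e₂ ∷ [] ×
      ((LitPlusSubset (pos φ) L e₁ × LitPlusSubset (neg φ) L e₂) ⊎
       (LitPlusSubset (neg φ) L e₁ × LitPlusSubset (pos φ) L e₂)))

    T4Node : Label → List (ℝ⁺ × Tree) → Set
    T4Node star       cs       = ⊤
    T4Node (clause L) []       = ⊤
    T4Node (clause L) (e ∷ es) =
      ∃[ c ] (All (λ e′ → proj₁ (proj₁ e′) ≡ c) (e ∷ es) ×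
              (CaseA L (e ∷ es) c ⊎ CaseB L (e ∷ es) c ⊎
               CaseC L (e ∷ es) c ⊎ CaseD L (e ∷ es) c))

    T2Node : ClauseSet → Label → List (ℝ⁺ × Tree) → Set
    T2Node Bη (clause L) [] = ∃[ K ] (K ∈ Bη × K ⊆ L)
    T2Node Bη _          _  = ⊤

    IsForestProof : Forest → Formula → Carrier → Formula → Set
    IsForestProof F ζ r η =
      (∃[ Bζ ] (ClauseSetFor Bζ ζ ×
        All (λ K → ∃[ t ] (t ∈ F × ∃[ L ] (root t ≡ clause L × L ⊆ K))) Bζ)) ×
      (∃[ Bη ] (ClauseSetFor Bη η × All (Every (T2Node Bη)) F)) ×
      (All (λ t → (b : Branch t) → branchLength b ≤ r) F) ×
      All (Every T4Node) F

    HasForestProof : GImp → Set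
    HasForestProof (ζ ⇒[ r ] η) = ∃[ F ] IsForestProof F ζ r η

module Submission where

-- For a proper node
-- labelled L we establish two facts simultaneously (the record NodeSound):
--   * if every branch below the node passes through ⋇, then T ⊢ L ⇒_0 ⊥;
--   * if every ⋇-free branch below the node has weight ≤ s, then T ⊢ L ⇒_s η.
-- Leaves are handled by (T2), inner nodes by the four cases of (T4): in each
-- case a small LAE-derivation turns the derivations for the children into one
-- for L ("node steps").  The first fact is what makes case (B) work when all
-- branches below carry ⋇, so that no weight bound at all is available and
-- rule R4 must remove the grade; deciding which situation occurs relies on
-- trees being finite (starFree?).

open import Defs
open import Function using (_∘_; Equivalence)
open import Data.Nat using (ℕ)
open import Data.Bool using (Bool; true; false; not; T; if_then_else_)
open import Data.Bool.Properties using (T-≡; T-∧; T-∨)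
open import Data.List using (List; []; _∷_; map; _++_)
open import Data.List.Membership.Propositional using (_∈_; find; lose)
open import Data.List.Relation.Unary.Any as Any using (Any; here; there)
open import Data.List.Relation.Unary.All as All using (All; []; _∷_)
open import Data.List.Relation.Unary.All.Properties using (anti-mono; ++⁺)
open import Data.List.Relation.Binary.Subset.Propositional using (_⊆_)
open import Data.Product using (∃-syntax; _×_; _,_; proj₁; proj₂)
open import Data.Sum using (_⊎_; inj₁; inj₂; [_,_]′) renaming (map to ⊎-map)
open import Data.Unit using (tt)
open import Data.Empty using (⊥-elim)
open import Relation.Nullary using (¬_; Dec; yes; no)
open import Relation.Nullary.Decidable using (map′; _⊎-dec_)
open import Relation.Binary.PropositionalEquality
  using (_≡_; refl; sym; trans; cong; subst; subst₂; module ≡-Reasoning)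
open import Algebra.Structures using (IsCommutativeRing)
open import Relation.Binary.Structures using (IsTotalOrder)

open Equivalence using (to; from)

_⊨_ : (ℕ → Bool) → Formula → Set
v ⊨ α = T (eval v α)

Entails : Formula → Formula → Set
Entails α β = ∀ v → v ⊨ α → v ⊨ β

entails⇒tautology : ∀ {α β} → Entails α β → Tautology (α →ᶠ β)
entails⇒tautology {α} h v with eval v α in eq
... | true  = to T-≡ (h v (subst T (sym eq) tt))
... | false = refl

T-or-T-not : ∀ b → T b ⊎ T (not b)
T-or-T-not true  = inj₁ tt
T-or-T-not false = inj₂ tt

module _ {A : Set} (g : A → Formula) (v : ℕ → Bool) where

  ⊨⋀⁺ : ∀ xs → All (λ x → v ⊨ g x) xs → v ⊨ ⋀ (map g xs)
  ⊨⋀⁺ []           []       = tt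
  ⊨⋀⁺ (x ∷ [])     (p ∷ []) = p
  ⊨⋀⁺ (x ∷ y ∷ ys) (p ∷ ps) = from T-∧ (p , ⊨⋀⁺ (y ∷ ys) ps)

  ⊨⋀⁻ : ∀ xs → v ⊨ ⋀ (map g xs) → All (λ x → v ⊨ g x) xs
  ⊨⋀⁻ []           _ = []
  ⊨⋀⁻ (x ∷ [])     p = p ∷ []
  ⊨⋀⁻ (x ∷ y ∷ ys) p = proj₁ (to T-∧ p) ∷ ⊨⋀⁻ (y ∷ ys) (proj₂ (to T-∧ p))

  ⊨⋁⁺ : ∀ xs → Any (λ x → v ⊨ g x) xs → v ⊨ ⋁ (map g xs)
  ⊨⋁⁺ (x ∷ [])     (here p)  = p
  ⊨⋁⁺ (x ∷ y ∷ ys) (here p)  = from T-∨ (inj₁ p)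
  ⊨⋁⁺ (x ∷ y ∷ ys) (there p) = from T-∨ (inj₂ (⊨⋁⁺ (y ∷ ys) p))

  ⊨⋁⁻ : ∀ xs → v ⊨ ⋁ (map g xs) → Any (λ x → v ⊨ g x) xs
  ⊨⋁⁻ (x ∷ [])     p = here p
  ⊨⋁⁻ (x ∷ y ∷ ys) p = [ here , there ∘ ⊨⋁⁻ (y ∷ ys) ]′ (to T-∨ p)

⊨clause⁺ : ∀ {v} L → All (λ x → v ⊨ litF x) L → v ⊨ clauseF L
⊨clause⁺ {v} = ⊨⋀⁺ litF v

⊨clause⁻ : ∀ {v} L → v ⊨ clauseF L → All (λ x → v ⊨ litF x) L
⊨clause⁻ {v} = ⊨⋀⁻ litF v

subclause-entails : ∀ {K L} → K ⊆ L → Entails (clauseF L) (clauseF K)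
subclause-entails {K} {L} K⊆L v p = ⊨clause⁺ K (anti-mono K⊆L (⊨clause⁻ L p))

inconsistent-entails-⊥ : ∀ {L} → Inconsistent L → Entails (clauseF L) ⊥ᶠ
inconsistent-entails-⊥ {L} (φ , pos∈L , neg∈L) v p =
  clash (v φ) (All.lookup holds pos∈L) (All.lookup holds neg∈L)
  where
  holds = ⊨clause⁻ L p
  clash : ∀ b → T b → T (not b) → T false
  clash true  _ ()
  clash false ()

entails-self-∧ : ∀ {α} → Entails α (α ∧ᶠ α)
entails-self-∧ {α} v p = from (T-∧ {eval v α}) (p , p)

distribute-entails : ∀ rhs L →
  Entails (f rhs ∧ᶠ clauseF L) (⋁ (map (λ μ → clauseF (μ ++ L)) rhs))
distribute-entails rhs L v p =
  ⊨⋁⁺ (λ μ → clauseF (μ ++ L)) v rhs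
    (Any.map (λ {μ} pμ → ⊨clause⁺ (μ ++ L) (++⁺ (⊨clause⁻ μ pμ) holdsL))
             (⊨⋁⁻ clauseF v rhs p∨))
  where
  p∨ = proj₁ (to T-∧ p)
  holdsL = ⊨clause⁻ L (proj₂ (to T-∧ p))

split-entails : ∀ φ {L L₊ L₋} → L₊ ⊆ pos φ ∷ L → L₋ ⊆ neg φ ∷ L →
  Entails (clauseF L) (clauseF L₊ ∨ᶠ clauseF L₋)
split-entails φ {L} {L₊} {L₋} sub₊ sub₋ v p =
  from T-∨ (⊎-map (λ φ-true  → ⊨clause⁺ L₊ (anti-mono sub₊ (φ-true  ∷ holds)))
                  (λ φ-false → ⊨clause⁺ L₋ (anti-mono sub₋ (φ-false ∷ holds)))
                  (T-or-T-not (v φ)))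
  where holds = ⊨clause⁻ L p

module ForestSoundness (ℝ : Reals) where
  open Reals ℝ
  open WithReals ℝ
  open IsCommutativeRing isCommutativeRing
    using (+-identityˡ; +-identityʳ; +-assoc; +-comm; -‿inverseˡ; -‿inverseʳ)
  open IsTotalOrder isTotalOrder using () renaming (refl to ≤-refl; trans to ≤-trans)

  +-nonneg : ∀ {a b} → 0# ≤ a → 0# ≤ b → 0# ≤ a + b
  +-nonneg {a} {b} 0≤a 0≤b =
    ≤-trans 0≤b (subst (_≤ a + b) (+-identityˡ b) (+-mono-≤ 0# a b 0≤a))

  ≤-+-nonneg : ∀ c {w} → 0# ≤ w → c ≤ c + w
  ≤-+-nonneg c {w} 0≤w = subst₂ _≤_ (+-identityˡ c) (+-comm w c) (+-mono-≤ 0# w c 0≤w)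

  ≤-subtract : ∀ c {x s} → c + x ≤ s → x ≤ s + - c
  ≤-subtract c {x} {s} le = subst (_≤ s + - c) cancel (+-mono-≤ (c + x) s (- c) le)
    where
    open ≡-Reasoning
    cancel : (c + x) + - c ≡ x
    cancel = begin
      (c + x) + - c ≡⟨ cong (_+ - c) (+-comm c x) ⟩
      (x + c) + - c ≡⟨ +-assoc x c (- c) ⟩
      x + (c + - c) ≡⟨ cong (x +_) (-‿inverseʳ c) ⟩
      x + 0#        ≡⟨ +-identityʳ x ⟩
      x             ∎

  +-difference : ∀ c s → c + (s + - c) ≡ s
  +-difference c s = begin
    c + (s + - c) ≡⟨ +-comm c _ ⟩
    (s + - c) + c ≡⟨ +-assoc s (- c) c ⟩
    s + (- c + c) ≡⟨ cong (s +_) (-‿inverseˡ c) ⟩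
    s + 0#        ≡⟨ +-identityʳ s ⟩
    s             ∎
    where open ≡-Reasoning

  StarFree : Tree → Set
  StarFree t = ∃[ b ] (hasStar {t} b ≡ false)

  BoundedBy : Tree → Carrier → Set
  BoundedBy t s = ∀ (b : Branch t) → hasStar b ≡ false → weightSum b ≤ s

  mutual
    starFree? : (t : Tree) → Dec (StarFree t)
    starFree? (node star       cs)       =
      no λ { (leaf , ()) ; (step _ _ , ()) }
    starFree? (node (clause L) [])       = yes (leaf , refl)
    starFree? (node (clause L) (e ∷ es)) = map′ fromChild toChild (someChildStarFree? (e ∷ es))
      where
      fromChild : Any (StarFree ∘ proj₂) (e ∷ es) → StarFree (node (clause L) (e ∷ es))
      fromChild any with find any
      ... | _ , e∈ , b , free = step e∈ b , free
      toChild : StarFree (node (clause L) (e ∷ es)) → Any (StarFree ∘ proj₂) (e ∷ es)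
      toChild (step e∈ b , free) = lose e∈ (b , free)

    someChildStarFree? : (cs : List (ℝ⁺ × Tree)) → Dec (Any (StarFree ∘ proj₂) cs)
    someChildStarFree? []             = no λ ()
    someChildStarFree? ((w , t) ∷ cs) =
      map′ Any.fromSum Any.toSum (starFree? t ⊎-dec someChildStarFree? cs)

  weightSum-nonneg : ∀ {t} (b : Branch t) → 0# ≤ weightSum b
  weightSum-nonneg leaf               = ≤-refl
  weightSum-nonneg (step {w = w} _ b) = +-nonneg (proj₂ w) (weightSum-nonneg b)

  length-starFree : ∀ {t} (b : Branch t) → hasStar b ≡ false → branchLength b ≡ weightSum b
  length-starFree b free = cong (λ z → if z then 0# else weightSum b) free

  module Derived (T : Theory) where

    precompose : ∀ {α β γ d} → 0# ≤ d →
      T ⊢ (α ⇒[ 0# ] β) → T ⊢ (β ⇒[ d ] γ) → T ⊢ (α ⇒[ d ] γ)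
    precompose {α} {γ = γ} {d} 0≤d p q =
      subst (λ z → T ⊢ (α ⇒[ z ] γ)) (+-identityˡ d) (R6 ≤-refl 0≤d p q)

    entailment : ∀ {α β} → Entails α β → T ⊢ (α ⇒[ 0# ] β)
    entailment {α} {β} h = R1 (entails⇒tautology {α} {β} h)

    ex-falso : ∀ {γ d} → 0# ≤ d → T ⊢ (⊥ᶠ ⇒[ d ] γ)
    ex-falso 0≤d = R3 ≤-refl 0≤d 0≤d (entailment λ _ ())

    strengthen : ∀ {K L γ d} → 0# ≤ d → K ⊆ L →
      T ⊢ (clauseF K ⇒[ d ] γ) → T ⊢ (clauseF L ⇒[ d ] γ)
    strengthen 0≤d K⊆L = precompose 0≤d (entailment (subclause-entails K⊆L))

    ⋁-left : ∀ {A : Set} {γ d} (g : A → Formula) xs → 0# ≤ d →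
      All (λ x → T ⊢ (g x ⇒[ d ] γ)) xs → T ⊢ (⋁ (map g xs) ⇒[ d ] γ)
    ⋁-left g []           0≤d []       = ex-falso 0≤d
    ⋁-left g (x ∷ [])     0≤d (p ∷ []) = p
    ⋁-left g (x ∷ y ∷ ys) 0≤d (p ∷ ps) = R5 0≤d p (⋁-left g (y ∷ ys) 0≤d ps)

    apply-basic : (b : BasicImp) → T (toGImp b) → ∀ {L} → BasicImp.lhs b ⊆ L →
      T ⊢ (clauseF L ⇒[ BasicImp.wt b ] f (BasicImp.rhs b))
    apply-basic b b∈T lhs⊆L = strengthen (BasicImp.wt-nonneg b) lhs⊆L (hyp b∈T)

    ChildrenDerive : List (ℝ⁺ × Tree) → Carrier → Formula → Set
    ChildrenDerive cs d γ =
      ∀ {e} → e ∈ cs → ∀ {L'} → root (proj₂ e) ≡ clause L' → T ⊢ (clauseF L' ⇒[ d ] γ)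

    from-child : ∀ {cs d γ S} → 0# ≤ d → ChildrenDerive cs d γ →
      SomeChildWithin cs S → T ⊢ (clauseF S ⇒[ d ] γ)
    from-child 0≤d children (e , e∈ , L' , root≡ , L'⊆S) =
      strengthen 0≤d L'⊆S (children e∈ root≡)

    -- (A): L ⇒₀ ⋁ᵢ μᵢ, hence L ⇒₀ (⋁ᵢ μᵢ) ∧ L ⇒₀ ⋁ᵢ (μᵢ ∪ L) ⇒_d γ.
    step-A : ∀ {L cs c d γ} → CaseA T L cs c → 0# ≤ d →
      ChildrenDerive cs d γ → T ⊢ (clauseF L ⇒[ d ] γ)
    step-A {L} (_ , b , b∈T , wt≡0 , lhs⊆L , within) 0≤d children =
      precompose 0≤d L⇒rhs∧L
        (precompose 0≤d (entailment (distribute-entails rhs L))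
          (⋁-left (λ μ → clauseF (μ ++ L)) rhs 0≤d
            (All.map (from-child 0≤d children) within)))
      where
      rhs : List Clause
      rhs = BasicImp.rhs b
      L⇒rhs : T ⊢ (clauseF L ⇒[ 0# ] f rhs)
      L⇒rhs = subst (λ z → T ⊢ (clauseF L ⇒[ z ] f rhs)) wt≡0 (apply-basic b b∈T lhs⊆L)
      L⇒rhs∧L : T ⊢ (clauseF L ⇒[ 0# ] f rhs ∧ᶠ clauseF L)
      L⇒rhs∧L = precompose ≤-refl (entailment (entails-self-∧ {clauseF L})) (R2 L⇒rhs)

    step-B : ∀ {L cs c d γ} → CaseB T L cs c → 0# ≤ d →
      ChildrenDerive cs d γ → T ⊢ (clauseF L ⇒[ c + d ] γ)
    step-B {L} {c = c} ((0≤c , _) , b , b∈T , wt≡c , lhs⊆L , within) 0≤d children =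
      R6 0≤c 0≤d L⇒rhs
        (⋁-left clauseF (BasicImp.rhs b) 0≤d (All.map (from-child 0≤d children) within))
      where
      L⇒rhs : T ⊢ (clauseF L ⇒[ c ] f (BasicImp.rhs b))
      L⇒rhs = subst (λ z → T ⊢ (clauseF L ⇒[ z ] _)) wt≡c (apply-basic b b∈T lhs⊆L)

    step-C : ∀ {L cs c d γ} → CaseC T L cs c → 0# ≤ d → T ⊢ (clauseF L ⇒[ d ] γ)
    step-C (_ , incons , _) 0≤d =
      precompose 0≤d (entailment (inconsistent-entails-⊥ incons)) (ex-falso 0≤d)

    step-split : ∀ φ {L cs e₊ e₋ d γ} → e₊ ∈ cs → LitPlusSubset (pos φ) L e₊ →
      e₋ ∈ cs → LitPlusSubset (neg φ) L e₋ → 0# ≤ d →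
      ChildrenDerive cs d γ → T ⊢ (clauseF L ⇒[ d ] γ)
    step-split φ e₊∈ (_ , root₊ , _ , sub₊) e₋∈ (_ , root₋ , _ , sub₋) 0≤d children =
      precompose 0≤d (entailment (split-entails φ sub₊ sub₋))
        (R5 0≤d (children e₊∈ root₊) (children e₋∈ root₋))

    step-D : ∀ {L cs c d γ} → CaseD T L cs c → 0# ≤ d →
      ChildrenDerive cs d γ → T ⊢ (clauseF L ⇒[ d ] γ)
    step-D (_ , φ , _ , _ , refl , inj₁ (child₊ , child₋)) =
      step-split φ (here refl) child₊ (there (here refl)) child₋
    step-D (_ , φ , _ , _ , refl , inj₂ (child₋ , child₊)) =
      step-split φ (there (here refl)) child₊ (here refl) child₋

  module Induction (T : Theory) (η : Formula) (Bη : ClauseSet)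
                   (Bη⇒η : Tautology (f Bη →ᶠ η)) where
    open Derived T

    record NodeSound (t : Tree) (L : Clause) : Set where
      field
        refute : ¬ StarFree t → T ⊢ (clauseF L ⇒[ 0# ] ⊥ᶠ)
        prove  : ∀ s → 0# ≤ s → BoundedBy t s → T ⊢ (clauseF L ⇒[ s ] η)

    Sound : Tree → Set
    Sound t = ∀ {L} → root t ≡ clause L → NodeSound t L

    -- A terminal clause includes a clause of Bη, so it implies η.
    leaf-sound : ∀ {L} → T2Node T Bη (clause L) [] → NodeSound (node (clause L) []) L
    leaf-sound {L} (K , K∈Bη , K⊆L) = record
      { refute = λ noFree → ⊥-elim (noFree (leaf , refl))
      ; prove  = λ s 0≤s _ →
          precompose 0≤s L⇒Bη (R3 ≤-refl 0≤s 0≤s (R1 Bη⇒η))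
      }
      where
      L⇒Bη : T ⊢ (clauseF L ⇒[ 0# ] f Bη)
      L⇒Bη = strengthen ≤-refl K⊆L (entailment λ v p → ⊨⋁⁺ clauseF v Bη (lose K∈Bη p))

    module InnerNode {L : Clause} {c : Carrier} {e : ℝ⁺ × Tree} {es : List (ℝ⁺ × Tree)}
        (weights : All (λ e′ → proj₁ (proj₁ e′) ≡ c) (e ∷ es))
        (children : All (Sound ∘ proj₂) (e ∷ es)) where

      cs : List (ℝ⁺ × Tree)
      cs = e ∷ es

      nd : Tree
      nd = node (clause L) cs

      refute-children : ¬ StarFree nd → ChildrenDerive cs 0# ⊥ᶠ
      refute-children noFree e∈ root≡ =
        NodeSound.refute (All.lookup children e∈ root≡)
          λ { (b , free) → noFree (step e∈ b , free) }

      child-bound : ∀ {s} → BoundedBy nd s → ∀ {e′} → e′ ∈ cs →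
        ∀ (b : Branch (proj₂ e′)) → hasStar b ≡ false → c + weightSum b ≤ s
      child-bound {s} bound e∈ b free =
        subst (λ z → z + weightSum b ≤ s) (All.lookup weights e∈) (bound (step e∈ b) free)

      prove-children : ∀ {s d} → 0# ≤ d → (∀ {w} → c + w ≤ s → w ≤ d) →
        BoundedBy nd s → ChildrenDerive cs d η
      prove-children 0≤d absorb bound e∈ root≡ =
        NodeSound.prove (All.lookup children e∈ root≡) _ 0≤d
          λ b free → absorb (child-bound bound e∈ b free)

      -- Cases (A), (C), (D) have grade 0: the bounds pass unchanged to the children.
      zero-weight : c ≡ 0# →
        (∀ {d γ} → 0# ≤ d → ChildrenDerive cs d γ → T ⊢ (clauseF L ⇒[ d ] γ)) →
        NodeSound nd L
      zero-weight c≡0 node-step = record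
        { refute = λ noFree → node-step ≤-refl (refute-children noFree)
        ; prove  = λ s 0≤s bound → node-step 0≤s (prove-children 0≤s drop-c bound)
        }
        where
        drop-c : ∀ {s w} → c + w ≤ s → w ≤ s
        drop-c {s} {w} = subst (_≤ s) (trans (cong (_+ w) c≡0) (+-identityˡ w))

      -- Case (B): the children get bound s - c, which is nonnegative as soon
      -- as some branch avoids ⋇; otherwise L is refuted and R4 applies.
      positive-weight : CaseB T L cs c → NodeSound nd L
      positive-weight caseB@((0≤c , _) , _) = record { refute = refute ; prove = prove }
        where
        refute : ¬ StarFree nd → T ⊢ (clauseF L ⇒[ 0# ] ⊥ᶠ)
        refute noFree = R4 0≤c
          (subst (λ z → T ⊢ (clauseF L ⇒[ z ] ⊥ᶠ)) (+-identityʳ c)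
            (step-B caseB ≤-refl (refute-children noFree)))

        prove : ∀ s → 0# ≤ s → BoundedBy nd s → T ⊢ (clauseF L ⇒[ s ] η)
        prove s 0≤s bound with starFree? nd
        ... | no noFree = precompose 0≤s (refute noFree) (ex-falso 0≤s)
        ... | yes (step e∈ b , free) =
          subst (λ z → T ⊢ (clauseF L ⇒[ z ] η)) (+-difference c s)
            (step-B caseB 0≤s-c (prove-children 0≤s-c (≤-subtract c) bound))
          where
          c≤s : c ≤ s
          c≤s = ≤-trans (≤-+-nonneg c (weightSum-nonneg b)) (child-bound bound e∈ b free)
          0≤s-c : 0# ≤ s + - c
          0≤s-c = ≤-subtract c (subst (_≤ s) (sym (+-identityʳ c)) c≤s)

    inner-node-sound : ∀ {L e es} → T4Node T (clause L) (e ∷ es) →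
      All (Sound ∘ proj₂) (e ∷ es) → NodeSound (node (clause L) (e ∷ es)) L
    inner-node-sound {L} (c , weights , case) children = by-case case
      where
      open InnerNode weights children
      by-case : CaseA T L cs c ⊎ CaseB T L cs c ⊎ CaseC T L cs c ⊎ CaseD T L cs c →
        NodeSound nd L
      by-case (inj₁ caseA)                 = zero-weight (proj₁ caseA) (step-A caseA)
      by-case (inj₂ (inj₁ caseB))          = positive-weight caseB
      by-case (inj₂ (inj₂ (inj₁ caseC)))   = zero-weight (proj₁ caseC) λ 0≤d _ → step-C caseC 0≤d
      by-case (inj₂ (inj₂ (inj₂ caseD)))   = zero-weight (proj₁ caseD) (step-D caseD)

    mutual
      tree-sound : ∀ t → Every (T4Node T) t → Every (T2Node T Bη) t → Sound t
      tree-sound (node star _) _ _ ()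
      tree-sound (node (clause L) []) _ (every t2 _) refl = leaf-sound t2
      tree-sound (node (clause L) (e ∷ es)) (every t4 below4) (every _ below2) refl =
        inner-node-sound t4 (children-sound (e ∷ es) below4 below2)

      children-sound : ∀ cs → All (Every (T4Node T) ∘ proj₂) cs →
        All (Every (T2Node T Bη) ∘ proj₂) cs → All (Sound ∘ proj₂) cs
      children-sound []             []             []             = []
      children-sound ((_ , t) ∷ cs) (t4 ∷ below4) (t2 ∷ below2) =
        tree-sound t t4 t2 ∷ children-sound cs below4 below2

  -- Soundness: ζ implies the disjunction of Bζ, each of whose clauses
  -- includes a root, and each root proves η at grade r by (T3).
  forest-proof-sound : (T : Theory) (ζ η : Formula) (r : Carrier) → 0# ≤ r →
    HasForestProof T (ζ ⇒[ r ] η) → T ⊢ (ζ ⇒[ r ] η)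
  forest-proof-sound T ζ η r 0≤r
    (F , (Bζ , (_ , ζ⇒Bζ) , roots) , (Bη , (Bη⇒η , _) , t2) , t3 , t4) =
    precompose 0≤r (R1 ζ⇒Bζ) (⋁-left clauseF Bζ 0≤r (All.map clause-proves roots))
    where
    open Derived T
    open Induction T η Bη Bη⇒η

    bounded : ∀ {t} → t ∈ F → BoundedBy t r
    bounded t∈F b free = subst (_≤ r) (length-starFree b free) (All.lookup t3 t∈F b)

    clause-proves : ∀ {K} → ∃[ t ] (t ∈ F × ∃[ L ] (root t ≡ clause L × L ⊆ K)) →
      T ⊢ (clauseF K ⇒[ r ] η)
    clause-proves (t , t∈F , L , root≡ , L⊆K) =
      strengthen 0≤r L⊆K
        (NodeSound.prove (tree-sound t (All.lookup t4 t∈F) (All.lookup t2 t∈F) root≡)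
          r 0≤r (bounded t∈F))

-- Theorem 3.7.
theorem3p7 : (ℝ : Reals) → let open WithReals ℝ in
    (T : Theory) → BasicTheory T →
    (ζ η : Formula) (r : Reals.Carrier ℝ) → Reals._≤_ ℝ (Reals.0# ℝ) r →
    HasForestProof T (ζ ⇒[ r ] η) → T ⊢ (ζ ⇒[ r ] η)
theorem3p7 ℝ T _ = ForestSoundness.forest-proof-sound ℝ T
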